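{- Let $k\ge1$, let $\omega=(\omega_1,\ldots,\omega_k)$ be a rational weight vector and $q\in\mathbb{Q}$. Define $H_{k,0,\omega}=1$ and, for $n\ge1$, $H_{k,n,\omega}=\sum_{\alpha\vdash n}L_{k,n,\omega}(\alpha)t^\alpha$, where $$L_{k,n,\omega}(\alpha)=\sum_{j=0}^{\sum_i\alpha_i-1}\frac{1}{\prod_i\alpha_i!}\binom{\sum_i\alpha_i-1}{j}B^q_{ -(j)}\,D_{(\sum_i\alpha_i-j-1)}(\omega_1^{\alpha_1}\cdots\omega_k^{\alpha_k}).$$ Then $(H_{k,n,\omega})_{n\ge0}$ is the $q$-th level root of the sequence $(P_{k,n,\omega})_{n\ge0}$ (with $P_{k,0,\omega}=1$).
   Context: Let $t_1,\ldots,t_k$ be indeterminates, $t^\alpha=t_1^{\alpha_1}\cdots t_k^{\alpha_k}$ for $\alpha\in\mathbb{Z}_{\ge0}^k$, $|\alpha|=\sum_i\alpha_i$, $\alpha\vdash n$ means $\sum_i i\alpha_i=n$, $e_j$ the $j$-th unit vector. For a weight vector $\omega$ define $A_\omega(e_j)=\omega_j$ and, for $|\alpha|\ge2$, $A_\omega(\alpha)=\sum_{j:\alpha_j\ge1}A_\omega(\alpha-e_j)$; the weighted isobaric polynomial is $P_{k,n,\omega}=\sum_{\alpha\vdash n}A_\omega(\alpha)t^\alpha$ for $n\ge1$, and $P_{k,0,\omega}:=1$. For $q\in\mathbb{Q}$ and $j\ge0$ let $B^q_{ -(j)}=q(q-1)\cdots(q-j)$. The operators $D_j$ act on polynomials in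 indeterminates $\omega_1,\ldots,\omega_k$: $D_0=\mathrm{id}$, $D_1=\sum_i\partial/\partial\omega_i$, $D_j=D_1\circ D_{j-1}$; the resulting polynomial is then evaluated at the given weight vector. The level product of sequences is $(P*Q)_n=\sum_{i=0}^nP_iQ_{n-i}$. For a sequence $(P_n)_{n\ge0}$ with $P_0=1$ and $q\in\mathbb{Q}$, its $q$-th level root is the sequence $(H_n)$ with $\sum_nH_ny^n=\big(\sum_nP_ny^n\big)^q:=\sum_{m\ge0}\binom{q}{m}\big(\sum_{n\ge1}P_ny^n\big)^m$; equivalently, for $q=s/m$ ($m\ge1$), the unique sequence with $H_0=1$ whose $m$-fold level product equals the $s$-fold level product of $(P_n)$ (of its inverse if $s<0$). -}

module Defs where

open import Data.Nat as ℕ using (ℕ; zero; suc; _∸_; _!; _≤ᵇ_)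
open import Data.Nat.Properties using (_!≢0)
open import Data.Nat.Combinatorics using (_C_)
open import Data.Integer using (+_)
open import Data.Rational using (ℚ; 0ℚ; 1ℚ; _+_; _*_; _-_; _/_)
open import Data.Bool using (Bool; true; false; if_then_else_; _∧_)
open import Data.Fin using (Fin)
open import Data.Vec using (Vec; []; _∷_; lookup; zipWith; replicate; allFin; toList)
open import Data.List using (List; []; _∷_; map; concatMap; foldr; upTo)
open import Data.Product using (_×_; _,_)

ℕ→ℚ : ℕ → ℚ
ℕ→ℚ n = + n / 1

sumℚ : List ℚ → ℚ
sumℚ = foldr _+_ 0ℚ

prodℚ : List ℚ → ℚ
prodℚ = foldr _*_ 1ℚ

_^ℚ_ : ℚ → ℕ → ℚ
x ^ℚ zero  = 1ℚ
x ^ℚ suc n = x * (x ^ℚ n)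

invFact : ℕ → ℚ
invFact m = (+ 1 / (m !)) {{m !≢0}}

Σ≤ : ℕ → (ℕ → ℚ) → ℚ
Σ≤ n f = sumℚ (map f (upTo (suc n)))

Exp : ℕ → Set
Exp k = Vec ℕ k

size : ∀ {k} → Exp k → ℕ
size []       = 0
size (a ∷ as) = a ℕ.+ size as

-- weight Σ_i i α_i (indices i = 1..k); α ⊢ n iff weight α ≡ n
weightFrom : ∀ {k} → ℕ → Exp k → ℕ
weightFrom i []       = 0
weightFrom i (a ∷ as) = i ℕ.* a ℕ.+ weightFrom (suc i) as

weight : ∀ {k} → Exp k → ℕ
weight = weightFrom 1

zeroExp : ∀ {k} → Exp k
zeroExp = replicate _ 0

_==ᵉ_ : ∀ {k} → Exp k → Exp k → Bool
[] ==ᵉ [] = true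
(a ∷ as) ==ᵉ (b ∷ bs) = (a ℕ.≡ᵇ b) ∧ (as ==ᵉ bs)

unit : ∀ {k} → Fin k → Exp k
unit {suc k} Fin.zero    = 1 ∷ zeroExp
unit {suc k} (Fin.suc j) = 0 ∷ unit j

_-ᵉ_ : ∀ {k} → Exp k → Exp k → Exp k
_-ᵉ_ = zipWith _∸_

below : ∀ {k} → Exp k → List (Exp k)
below []       = [] ∷ []
below (a ∷ as) = concatMap (λ b → map (b ∷_) (below as)) (upTo (suc a))

-- Polynomials in t_1..t_k with rational coefficients,
-- represented by their coefficient function α ↦ [t^α]

Poly : ℕ → Set
Poly k = Exp k → ℚ

0P : ∀ {k} → Poly k
0P _ = 0ℚ

1P : ∀ {k} → Poly k
1P α = if α ==ᵉ zeroExp then 1ℚ else 0ℚ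

_+P_ : ∀ {k} → Poly k → Poly k → Poly k
(f +P g) α = f α + g α

_·P_ : ∀ {k} → ℚ → Poly k → Poly k
(c ·P f) α = c * f α

_*P_ : ∀ {k} → Poly k → Poly k → Poly k
(f *P g) α = sumℚ (map (λ β → f β * g (α -ᵉ β)) (below α))

ΣP≤ : ∀ {k} → ℕ → (ℕ → Poly k) → Poly k
ΣP≤ n F α = Σ≤ n (λ i → F i α)

Seq : ℕ → Set
Seq k = ℕ → Poly k

levelProd : ∀ {k} → Seq k → Seq k → Seq k
levelProd P Q n = ΣP≤ n (λ i → P i *P Q (n ∸ i))

unitSeq : ∀ {k} → Seq k
unitSeq zero    = 1P
unitSeq (suc n) = 0P

levelPow : ∀ {k} → Seq k → ℕ → Seq k
levelPow P zero    = unitSeq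
levelPow P (suc m) = levelProd P (levelPow P m)

dropConst : ∀ {k} → Seq k → Seq k
dropConst P zero    = 0P
dropConst P (suc n) = P (suc n)

fallingℚ : ℚ → ℕ → ℚ
fallingℚ q zero    = 1ℚ
fallingℚ q (suc m) = fallingℚ q m * (q - ℕ→ℚ m)

binomℚ : ℚ → ℕ → ℚ
binomℚ q m = fallingℚ q m * invFact m

-- q-th level root: Σ H_n y^n = Σ_{m≥0} binom(q,m) (Σ_{n≥1} P_n y^n)^m.
-- The coefficient of y^n only receives contributions from m ≤ n.
levelRoot : ∀ {k} → ℚ → Seq k → Seq k
levelRoot q P n = ΣP≤ n (λ m → binomℚ q m ·P levelPow (dropConst P) m n)

Weight : ℕ → Set
Weight k = Vec ℚ k

-- A_ω with explicit fuel d = |α|: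
--   A(e_j) = ω_j,   A(α) = Σ_{j : α_j ≥ 1} A(α - e_j)  for |α| ≥ 2
Aaux : ∀ {k} → Weight k → ℕ → Exp k → ℚ
Aaux ω zero          α = 0ℚ
Aaux ω (suc zero)    α =
  sumℚ (map (λ j → if 1 ≤ᵇ lookup α j then lookup ω j else 0ℚ) (toList (allFin _)))
Aaux ω (suc (suc d)) α =
  sumℚ (map (λ j → if 1 ≤ᵇ lookup α j then Aaux ω (suc d) (α -ᵉ unit j) else 0ℚ)
            (toList (allFin _)))

A : ∀ {k} → Weight k → Exp k → ℚ
A ω α = Aaux ω (size α) α

isobaric : ∀ {k} → Weight k → Seq k
isobaric ω zero    = 1P
isobaric ω (suc n) α = if weight α ℕ.≡ᵇ suc n then A ω α else 0ℚ

MPoly : ℕ → Set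
MPoly k = List (ℚ × Exp k)

monomial : ∀ {k} → Exp k → MPoly k
monomial β = (1ℚ , β) ∷ []

∂ : ∀ {k} → Fin k → MPoly k → MPoly k
∂ i = map (λ { (c , β) → (c * ℕ→ℚ (lookup β i) , β -ᵉ unit i) })

D₁ : ∀ {k} → MPoly k → MPoly k
D₁ p = concatMap (λ i → ∂ i p) (toList (allFin _))

D : ∀ {k} → ℕ → MPoly k → MPoly k
D zero    p = p
D (suc j) p = D₁ (D j p)

evalMono : ∀ {k} → Weight k → Exp k → ℚ
evalMono []       []       = 1ℚ
evalMono (w ∷ ws) (b ∷ bs) = (w ^ℚ b) * evalMono ws bs

eval : ∀ {k} → Weight k → MPoly k → ℚ
eval ω p = sumℚ (map (λ { (c , β) → c * evalMono ω β }) p)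

B : ℚ → ℕ → ℚ
B q j = fallingℚ q (suc j)

invFactProd : ∀ {k} → Exp k → ℚ
invFactProd α = prodℚ (map invFact (toList α))

L : ∀ {k} → Weight k → ℚ → Exp k → ℚ
L ω q α = sumℚ (map term (upTo (size α)))
  where
  term : ℕ → ℚ
  term j = invFactProd α * ℕ→ℚ ((size α ∸ 1) C j) * B q j
             * eval ω (D (size α ∸ j ∸ 1) (monomial α))

Hseq : ∀ {k} → Weight k → ℚ → Seq k
Hseq ω q zero      = 1P
Hseq ω q (suc n) α = if weight α ℕ.≡ᵇ suc n then L ω q α else 0ℚ

-- The m-th level power of (P_{k,n,ω})_{n ≥ 1} is the weight grading of a^m, where a = Σ_α A_ω(α) t^α,
-- so the theorem is the identity Σ_m binom(q, m) [t^α] a^m = L_{k,n,ω}(α) for each α of weight n ≥ 1.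
-- With s = Σ_j t_j and s_ω = Σ_j ω_j t_j, the recursion defining A_ω says a = s_ω + s·a, hence
-- a^(m+1) = s_ω·a^m + s·a^(m+1), which determines [t^α] a^(m+1) by induction on |α|. Writing
-- G_r(α) = (1/α!) D_r(ω^α), one has G_(r+1) = s·G_r, and s_ω·G_r = (|α| - r) G_r (an Euler identity for the
-- homogeneous ω^α); with Pascal's rule these show that (m+1)! C(|α|-1, m) G_(|α|-1-m)(α) satisfies the same
-- recursion, so it is [t^α] a^(m+1). Finally binom(q, m+1) (m+1)! = B^q_{-(m)}, which is the j = m term of L.

module Submission where

open import Algebra.Bundles using (Ring; CommutativeMonoid)
import Algebra.Properties.CommutativeSemigroup as CommutativeSemigroup
import Algebra.Properties.Semiring.Sum as Sum
open import Data.Bool using (true; false; if_then_else_; T)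
open import Data.Bool.Properties using (if-eta; if-cong-then)
open import Data.Fin as Fin using (Fin; toℕ)
open import Data.Fin.Properties using (toℕ<n)
import Data.Integer as ℤ
import Data.Integer.Properties as ℤ
open import Data.List as List using (List; []; _∷_; map; concatMap; upTo; applyUpTo; _++_)
import Data.List.Properties as List
open import Data.Nat as ℕ using (ℕ; zero; suc; _∸_; _!; _≡ᵇ_; _≤_; _<_; _≥_; z≤n; s≤s)
import Data.Nat.Properties as ℕ
open import Data.Nat.Combinatorics using (_C_; k>n⇒nCk≡0; nCk+nC[k+1]≡[n+1]C[k+1])
open import Data.Nat.GeneralisedArithmetic using (fold; iterate; iterate-is-fold)
open import Data.Product using (_×_; _,_; ∃)
open import Data.Rational using (ℚ; 0ℚ; 1ℚ; _+_; _*_; _/_; toℚᵘ)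
import Data.Rational.Properties as ℚ
open import Data.Rational.Solver using (module +-*-Solver)
import Data.Rational.Unnormalised as ℚᵘ
import Data.Rational.Unnormalised.Properties as ℚᵘ
open import Data.Vec using ([]; _∷_; lookup; tabulate; allFin; toList)
open import Data.Vec.Relation.Binary.Pointwise.Inductive using (Pointwise; []; _∷_)
open import Function using (_∘_)
open import Relation.Binary.PropositionalEquality
  using (_≡_; refl; sym; trans; cong; cong₂; subst; subst₂; module ≡-Reasoning)
open import Relation.Nullary using (yes; no; contradiction)

open import Defs

open Sum (Ring.semiring ℚ.+-*-ring)
  using (sum-syntax; sum-cong-≗; sum-replicate-zero; ∑-distrib-+; ∑-comm; *-distribˡ-sum; *-distribʳ-sum)
open CommutativeSemigroup (CommutativeMonoid.commutativeSemigroup ℚ.*-1-commutativeMonoid)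
  using (x∙yz≈y∙xz)
open CommutativeSemigroup ℕ.+-commutativeSemigroup using () renaming (interchange to +-interchange)
open +-*-Solver
open ≡-Reasoning

variable
  k : ℕ

ℕ→ℚ-toℚᵘ : ∀ n → toℚᵘ (ℕ→ℚ n) ℚᵘ.≃ ℚᵘ.mkℚᵘ (ℤ.+ n) 0
ℕ→ℚ-toℚᵘ n = ℚ.toℚᵘ-fromℚᵘ (ℚᵘ.mkℚᵘ (ℤ.+ n) 0)

ℕ→ℚ-+ : ∀ m n → ℕ→ℚ (m ℕ.+ n) ≡ ℕ→ℚ m + ℕ→ℚ n
ℕ→ℚ-+ m n = ℚ.toℚᵘ-injective
  (ℚᵘ.≃-trans (ℕ→ℚ-toℚᵘ (m ℕ.+ n)) (ℚᵘ.≃-trans (ℚᵘ.*≡* integers) (ℚᵘ.≃-sym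
    (ℚᵘ.≃-trans (ℚ.toℚᵘ-homo-+ (ℕ→ℚ m) (ℕ→ℚ n)) (ℚᵘ.+-cong (ℕ→ℚ-toℚᵘ m) (ℕ→ℚ-toℚᵘ n))))))
  where
  integers : ℤ.+ (m ℕ.+ n) ℤ.* ℤ.+ 1 ≡ (ℤ.+ m ℤ.* ℤ.+ 1 ℤ.+ ℤ.+ n ℤ.* ℤ.+ 1) ℤ.* ℤ.+ 1
  integers = cong (ℤ._* ℤ.+ 1) (trans (ℤ.pos-+ m n)
    (sym (cong₂ ℤ._+_ (ℤ.*-identityʳ (ℤ.+ m)) (ℤ.*-identityʳ (ℤ.+ n)))))

ℕ→ℚ-* : ∀ m n → ℕ→ℚ (m ℕ.* n) ≡ ℕ→ℚ m * ℕ→ℚ n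
ℕ→ℚ-* m n = ℚ.toℚᵘ-injective
  (ℚᵘ.≃-trans (ℕ→ℚ-toℚᵘ (m ℕ.* n)) (ℚᵘ.≃-trans (ℚᵘ.*≡* integers) (ℚᵘ.≃-sym
    (ℚᵘ.≃-trans (ℚ.toℚᵘ-homo-* (ℕ→ℚ m) (ℕ→ℚ n)) (ℚᵘ.*-cong (ℕ→ℚ-toℚᵘ m) (ℕ→ℚ-toℚᵘ n))))))
  where
  integers : ℤ.+ (m ℕ.* n) ℤ.* ℤ.+ 1 ≡ (ℤ.+ m ℤ.* ℤ.+ n) ℤ.* ℤ.+ 1
  integers = cong (ℤ._* ℤ.+ 1) (ℤ.pos-* m n)

1/d*d≡1 : ∀ d .{{_ : ℕ.NonZero d}} → (ℤ.+ 1 / d) * ℕ→ℚ d ≡ 1ℚ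
1/d*d≡1 (suc d) = ℚ.toℚᵘ-injective (ℚᵘ.≃-trans (ℚ.toℚᵘ-homo-* (ℤ.+ 1 / suc d) (ℕ→ℚ (suc d)))
  (ℚᵘ.≃-trans (ℚᵘ.*-cong (ℚ.toℚᵘ-fromℚᵘ (ℚᵘ.mkℚᵘ (ℤ.+ 1) d)) (ℕ→ℚ-toℚᵘ (suc d)))
  (ℚᵘ.≃-trans (ℚᵘ.*≡* integers) (ℚᵘ.≃-sym (ℕ→ℚ-toℚᵘ 1)))))
  where
  integers : (ℤ.+ 1 ℤ.* ℤ.+ suc d) ℤ.* ℤ.+ 1 ≡ ℤ.+ 1 ℤ.* ℤ.+ (suc d ℕ.* 1)
  integers = trans (ℤ.*-identityʳ _) (trans (ℤ.*-identityˡ _)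
    (sym (trans (ℤ.*-identityˡ _) (cong ℤ.+_ (ℕ.*-identityʳ (suc d))))))

invFact-* : ∀ n → invFact n * ℕ→ℚ (n !) ≡ 1ℚ
invFact-* n = 1/d*d≡1 (n !) {{n ℕ.!≢0}}

invFact-suc : ∀ n → invFact (suc n) * ℕ→ℚ (suc n) ≡ invFact n
invFact-suc n = begin
  x * s                   ≡⟨ ℚ.*-identityʳ (x * s) ⟨
  x * s * 1ℚ              ≡⟨ cong (x * s *_) (trans (ℚ.*-comm f i) (invFact-* n)) ⟨
  x * s * (f * i)         ≡⟨ solve 4 (λ x s f i → x :* s :* (f :* i) := x :* (s :* f) :* i) refl x s f i ⟩
  x * (s * f) * i         ≡⟨ cong (λ z → x * z * i) (ℕ→ℚ-* (suc n) (n !)) ⟨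
  x * ℕ→ℚ (suc n !) * i   ≡⟨ cong (_* i) (invFact-* (suc n)) ⟩
  1ℚ * i                  ≡⟨ ℚ.*-identityˡ i ⟩
  i                       ∎
  where
  x = invFact (suc n); s = ℕ→ℚ (suc n); f = ℕ→ℚ (n !); i = invFact n

sumℕ : ℕ → (ℕ → ℚ) → ℚ
sumℕ n f = ∑[ i < n ] f (toℕ i)

sumℕ-cong< : ∀ n {f g : ℕ → ℚ} → (∀ i → i < n → f i ≡ g i) → sumℕ n f ≡ sumℕ n g
sumℕ-cong< n eq = sum-cong-≗ {n} (λ i → eq (toℕ i) (toℕ<n i))

sumℕ-cong : ∀ n {f g : ℕ → ℚ} → (∀ i → f i ≡ g i) → sumℕ n f ≡ sumℕ n g
sumℕ-cong n eq = sum-cong-≗ {n} (eq ∘ toℕ)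

sumℕ-vanishing : ∀ {m n} (f : ℕ → ℚ) → (∀ i → n ≤ i → f i ≡ 0ℚ) → n ≤ m →
  sumℕ m f ≡ sumℕ n f
sumℕ-vanishing {m} {zero} f vanish _ = trans (sumℕ-cong m (λ i → vanish i z≤n)) (sum-replicate-zero m)
sumℕ-vanishing {suc m} {suc n} f vanish (s≤s n≤m) =
  cong (f 0 +_) (sumℕ-vanishing (f ∘ suc) (λ i n≤i → vanish (suc i) (s≤s n≤i)) n≤m)

sumℚ-map-applyUpTo : ∀ (f : ℕ → ℚ) g n → sumℚ (map f (applyUpTo g n)) ≡ sumℕ n (f ∘ g)
sumℚ-map-applyUpTo f g zero    = refl
sumℚ-map-applyUpTo f g (suc n) = cong (f (g 0) +_) (sumℚ-map-applyUpTo f (g ∘ suc) n)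

sumℚ-map-upTo : ∀ (f : ℕ → ℚ) n → sumℚ (map f (upTo n)) ≡ sumℕ n f
sumℚ-map-upTo f = sumℚ-map-applyUpTo f (λ i → i)

sumℚ-map-tabulate : ∀ {A : Set} (f : A → ℚ) (g : Fin k → A) →
  sumℚ (map f (toList (tabulate g))) ≡ ∑[ i < k ] f (g i)
sumℚ-map-tabulate {k = zero}  f g = refl
sumℚ-map-tabulate {k = suc k} f g = cong (f (g Fin.zero) +_) (sumℚ-map-tabulate f (g ∘ Fin.suc))

sumℚ-map-allFin : ∀ (f : Fin k → ℚ) → sumℚ (map f (toList (allFin k))) ≡ ∑[ i < k ] f i
sumℚ-map-allFin f = sumℚ-map-tabulate f (λ i → i)

sumℚ-++ : ∀ xs ys → sumℚ (xs ++ ys) ≡ sumℚ xs + sumℚ ys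
sumℚ-++ []       ys = sym (ℚ.+-identityˡ _)
sumℚ-++ (x ∷ xs) ys = trans (cong (x +_) (sumℚ-++ xs ys)) (sym (ℚ.+-assoc x (sumℚ xs) (sumℚ ys)))

sumℚ-map-concatMap : ∀ {A B : Set} (f : B → ℚ) (g : A → List B) xs →
  sumℚ (map f (concatMap g xs)) ≡ sumℚ (map (λ x → sumℚ (map f (g x))) xs)
sumℚ-map-concatMap f g []       = refl
sumℚ-map-concatMap f g (x ∷ xs) = begin
  sumℚ (map f (g x ++ concatMap g xs))
    ≡⟨ cong sumℚ (List.map-++ f (g x) (concatMap g xs)) ⟩
  sumℚ (map f (g x) ++ map f (concatMap g xs))
    ≡⟨ sumℚ-++ (map f (g x)) _ ⟩
  sumℚ (map f (g x)) + sumℚ (map f (concatMap g xs))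
    ≡⟨ cong (sumℚ (map f (g x)) +_) (sumℚ-map-concatMap f g xs) ⟩
  sumℚ (map (λ x → sumℚ (map f (g x))) (x ∷ xs)) ∎

if-*-if : ∀ b c x y →
  (if b then x else 0ℚ) * (if c then y else 0ℚ) ≡ (if b then (if c then x * y else 0ℚ) else 0ℚ)
if-*-if true  true  x y = refl
if-*-if true  false x y = ℚ.*-zeroʳ x
if-*-if false c     x y = ℚ.*-zeroˡ (if c then y else 0ℚ)

sumℕ-diagonal : ∀ n a b x →
  sumℕ (suc n) (λ i → if a ≡ᵇ i then (if b ≡ᵇ n ∸ i then x else 0ℚ) else 0ℚ)
    ≡ (if a ℕ.+ b ≡ᵇ n then x else 0ℚ)
sumℕ-diagonal zero    zero    b x = ℚ.+-identityʳ _
sumℕ-diagonal zero    (suc a) b x = ℚ.+-identityʳ _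
sumℕ-diagonal (suc n) zero    b x =
  trans (cong ((if b ≡ᵇ suc n then x else 0ℚ) +_) (sum-replicate-zero (suc n))) (ℚ.+-identityʳ _)
sumℕ-diagonal (suc n) (suc a) b x = trans (ℚ.+-identityˡ _) (sumℕ-diagonal n a b x)

-ᵉ-identityʳ : ∀ (α : Exp k) → α -ᵉ zeroExp ≡ α
-ᵉ-identityʳ []      = refl
-ᵉ-identityʳ (a ∷ α) = cong (a ∷_) (-ᵉ-identityʳ α)

size-unit : ∀ (α : Exp k) j {c} → lookup α j ≡ suc c → suc (size (α -ᵉ unit j)) ≡ size α
size-unit (a ∷ α) Fin.zero    refl rewrite -ᵉ-identityʳ α = refl
size-unit (a ∷ α) (Fin.suc j) eq   = trans (sym (ℕ.+-suc a _)) (cong (a ℕ.+_) (size-unit α j eq))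

size-sum : ∀ (α : Exp k) → ∑[ j < k ] ℕ→ℚ (lookup α j) ≡ ℕ→ℚ (size α)
size-sum []      = refl
size-sum (a ∷ α) = trans (cong (ℕ→ℚ a +_) (size-sum α)) (sym (ℕ→ℚ-+ a (size α)))

size≤weightFrom : ∀ i (α : Exp k) → size α ≤ weightFrom (suc i) α
size≤weightFrom i []      = z≤n
size≤weightFrom i (a ∷ α) = ℕ.+-mono-≤ (ℕ.m≤m+n a (i ℕ.* a)) (size≤weightFrom (suc i) α)

size≡0⇒weightFrom≡0 : ∀ i (α : Exp k) → size α ≡ 0 → weightFrom i α ≡ 0
size≡0⇒weightFrom≡0 i []         _   = refl
size≡0⇒weightFrom≡0 i (zero ∷ α) α≡0 =
  trans (cong (ℕ._+ weightFrom (suc i) α) (ℕ.*-zeroʳ i)) (size≡0⇒weightFrom≡0 (suc i) α α≡0)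

weight≡suc⇒size≡suc : ∀ (α : Exp k) {n} → weight α ≡ suc n → ∃ λ N → size α ≡ suc N × N ≤ n
weight≡suc⇒size≡suc α w≡1+n with size α in eq
... | zero  = contradiction (trans (sym (size≡0⇒weightFrom≡0 1 α eq)) w≡1+n) λ ()
... | suc N = N , refl , ℕ.≤-pred (subst₂ _≤_ eq w≡1+n (size≤weightFrom 0 α))

weightFrom-+-∸ : ∀ i {β α : Exp k} → Pointwise _≤_ β α →
  weightFrom i β ℕ.+ weightFrom i (α -ᵉ β) ≡ weightFrom i α
weightFrom-+-∸ i []                         = refl
weightFrom-+-∸ i {b ∷ β} {a ∷ α} (b≤a ∷ β≤α) = begin
  (i ℕ.* b ℕ.+ weightFrom (suc i) β) ℕ.+ (i ℕ.* (a ∸ b) ℕ.+ weightFrom (suc i) (α -ᵉ β))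
    ≡⟨ +-interchange (i ℕ.* b) _ _ _ ⟩
  (i ℕ.* b ℕ.+ i ℕ.* (a ∸ b)) ℕ.+ (weightFrom (suc i) β ℕ.+ weightFrom (suc i) (α -ᵉ β))
    ≡⟨ cong₂ ℕ._+_ (trans (sym (ℕ.*-distribˡ-+ i b (a ∸ b))) (cong (i ℕ.*_) (ℕ.m+[n∸m]≡n b≤a)))
                   (weightFrom-+-∸ (suc i) β≤α) ⟩
  i ℕ.* a ℕ.+ weightFrom (suc i) α ∎

1P-size : ∀ (α : Exp k) → 1P α ≡ (if size α ≡ᵇ 0 then 1ℚ else 0ℚ)
1P-size []          = refl
1P-size (zero ∷ α)  = 1P-size α
1P-size (suc a ∷ α) = refl

1P-size≡0 : ∀ (α : Exp k) → size α ≡ 0 → 1P α ≡ 1ℚ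
1P-size≡0 α α≡0 = trans (1P-size α) (cong (λ s → if s ≡ᵇ 0 then 1ℚ else 0ℚ) α≡0)

1P-size≡suc : ∀ (α : Exp k) {N} → size α ≡ suc N → 1P α ≡ 0ℚ
1P-size≡suc α α≡1+N = trans (1P-size α) (cong (λ s → if s ≡ᵇ 0 then 1ℚ else 0ℚ) α≡1+N)

1P-weight≡suc : ∀ (α : Exp k) {w} → weight α ≡ suc w → 1P α ≡ 0ℚ
1P-weight≡suc α w≡1+w with weight≡suc⇒size≡suc α w≡1+w
... | _ , α≡1+N , _ = 1P-size≡suc α α≡1+N

sumBelow : Exp k → (Exp k → ℚ) → ℚ
sumBelow []      F = F []
sumBelow (a ∷ α) F = sumℕ (suc a) (λ b → sumBelow α (F ∘ (b ∷_)))

sumℚ-map-below : ∀ (α : Exp k) F → sumℚ (map F (below α)) ≡ sumBelow α F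
sumℚ-map-below []      F = ℚ.+-identityʳ (F [])
sumℚ-map-below (a ∷ α) F = begin
  sumℚ (map F (concatMap (λ b → map (b ∷_) (below α)) (upTo (suc a))))
    ≡⟨ sumℚ-map-concatMap F (λ b → map (b ∷_) (below α)) (upTo (suc a)) ⟩
  sumℚ (map (λ b → sumℚ (map F (map (b ∷_) (below α)))) (upTo (suc a)))
    ≡⟨ sumℚ-map-upTo (λ b → sumℚ (map F (map (b ∷_) (below α)))) (suc a) ⟩
  sumℕ (suc a) (λ b → sumℚ (map F (map (b ∷_) (below α))))
    ≡⟨ sumℕ-cong (suc a) (λ b → trans (cong sumℚ (sym (List.map-∘ {g = F} {f = b ∷_} (below α))))
                                      (sumℚ-map-below α (F ∘ (b ∷_)))) ⟩
  sumBelow (a ∷ α) F ∎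

sumBelow-cong≤ : ∀ (α : Exp k) {F G : Exp k → ℚ} → (∀ β → Pointwise _≤_ β α → F β ≡ G β) →
  sumBelow α F ≡ sumBelow α G
sumBelow-cong≤ []      eq = eq [] []
sumBelow-cong≤ (a ∷ α) eq =
  sumℕ-cong< (suc a) (λ b b<1+a → sumBelow-cong≤ α (λ β β≤α → eq (b ∷ β) (ℕ.≤-pred b<1+a ∷ β≤α)))

sumBelow-cong : ∀ (α : Exp k) {F G : Exp k → ℚ} → (∀ β → F β ≡ G β) →
  sumBelow α F ≡ sumBelow α G
sumBelow-cong α eq = sumBelow-cong≤ α (λ β _ → eq β)

sumBelow-zero : ∀ (α : Exp k) → sumBelow α (λ _ → 0ℚ) ≡ 0ℚ
sumBelow-zero []      = refl
sumBelow-zero (a ∷ α) = trans (sumℕ-cong (suc a) (λ _ → sumBelow-zero α)) (sum-replicate-zero (suc a))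

sumBelow-+ : ∀ (α : Exp k) F G → sumBelow α (λ β → F β + G β) ≡ sumBelow α F + sumBelow α G
sumBelow-+ []      F G = refl
sumBelow-+ (a ∷ α) F G = trans (sumℕ-cong (suc a) (λ b → sumBelow-+ α (F ∘ (b ∷_)) (G ∘ (b ∷_))))
  (∑-distrib-+ {suc a} (λ b → sumBelow α (F ∘ (toℕ b ∷_))) (λ b → sumBelow α (G ∘ (toℕ b ∷_))))

sumBelow-*ˡ : ∀ (α : Exp k) c F → sumBelow α (λ β → c * F β) ≡ c * sumBelow α F
sumBelow-*ˡ []      c F = refl
sumBelow-*ˡ (a ∷ α) c F = trans (sumℕ-cong (suc a) (λ b → sumBelow-*ˡ α c (F ∘ (b ∷_))))
                                (sym (*-distribˡ-sum {suc a} c (λ b → sumBelow α (F ∘ (toℕ b ∷_)))))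

sumBelow-sum : ∀ {n} (α : Exp k) (F : Fin n → Exp k → ℚ) →
  sumBelow α (λ β → ∑[ i < n ] F i β) ≡ ∑[ i < n ] sumBelow α (F i)
sumBelow-sum []      F = refl
sumBelow-sum (a ∷ α) F = trans (sumℕ-cong (suc a) (λ b → sumBelow-sum α (λ i → F i ∘ (b ∷_))))
                               (∑-comm {suc a} (λ b i → sumBelow α (F i ∘ (toℕ b ∷_))))

sumBelow-if : ∀ b (α : Exp k) F →
  sumBelow α (λ β → if b then F β else 0ℚ) ≡ (if b then sumBelow α F else 0ℚ)
sumBelow-if true  α F = refl
sumBelow-if false α F = sumBelow-zero α

ifPos : ℕ → ℚ → ℚ
ifPos n x = if 1 ℕ.≤ᵇ n then x else 0ℚ

ifPos-zero : ∀ n → ifPos n 0ℚ ≡ 0ℚ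
ifPos-zero zero    = refl
ifPos-zero (suc n) = refl

ifPos-*ˡ : ∀ n c x → ifPos n (c * x) ≡ c * ifPos n x
ifPos-*ˡ zero    c x = sym (ℚ.*-zeroʳ c)
ifPos-*ˡ (suc n) c x = refl

ifPos-sum : ∀ {m} n (f : Fin m → ℚ) → ifPos n (∑[ i < m ] f i) ≡ ∑[ i < m ] ifPos n (f i)
ifPos-sum {m} zero    f = sym (sum-replicate-zero m)
ifPos-sum     (suc n) f = refl

ifPos-comm : ∀ m n x → ifPos m (ifPos n x) ≡ ifPos n (ifPos m x)
ifPos-comm zero    zero    x = refl
ifPos-comm zero    (suc n) x = refl
ifPos-comm (suc m) zero    x = refl
ifPos-comm (suc m) (suc n) x = refl

mulVar : Fin k → Poly k → Poly k
mulVar j X α = ifPos (lookup α j) (X (α -ᵉ unit j))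

mulVar-cong-size : ∀ j {X Y : Poly k} α → (∀ β → suc (size β) ≡ size α → X β ≡ Y β) →
  mulVar j X α ≡ mulVar j Y α
mulVar-cong-size j α eq with lookup α j in e
... | zero  = refl
... | suc c = eq (α -ᵉ unit j) (size-unit α j e)

mulVar-comm-zero : ∀ (j : Fin k) X a α →
  mulVar Fin.zero (mulVar (Fin.suc j) X) (a ∷ α) ≡ mulVar (Fin.suc j) (mulVar Fin.zero X) (a ∷ α)
mulVar-comm-zero j X a α = begin
  ifPos a (ifPos (lookup (α -ᵉ zeroExp) j) (X ((a ∸ 1) ∷ ((α -ᵉ zeroExp) -ᵉ unit j))))
    ≡⟨ cong (λ γ → ifPos a (ifPos (lookup γ j) (X ((a ∸ 1) ∷ (γ -ᵉ unit j))))) (-ᵉ-identityʳ α) ⟩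
  ifPos a (ifPos (lookup α j) (X ((a ∸ 1) ∷ (α -ᵉ unit j))))
    ≡⟨ ifPos-comm a (lookup α j) _ ⟩
  ifPos (lookup α j) (ifPos a (X ((a ∸ 1) ∷ (α -ᵉ unit j))))
    ≡⟨ cong (λ γ → ifPos (lookup α j) (ifPos a (X ((a ∸ 1) ∷ γ)))) (-ᵉ-identityʳ (α -ᵉ unit j)) ⟨
  ifPos (lookup α j) (ifPos a (X ((a ∸ 1) ∷ ((α -ᵉ unit j) -ᵉ zeroExp)))) ∎

mulVar-comm : ∀ (i j : Fin k) X α → mulVar i (mulVar j X) α ≡ mulVar j (mulVar i X) α
mulVar-comm Fin.zero    Fin.zero    X (a ∷ α) = refl
mulVar-comm Fin.zero    (Fin.suc j) X (a ∷ α) = mulVar-comm-zero j X a α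
mulVar-comm (Fin.suc i) Fin.zero    X (a ∷ α) = sym (mulVar-comm-zero i X a α)
mulVar-comm (Fin.suc i) (Fin.suc j) X (a ∷ α) = mulVar-comm i j (X ∘ (a ∷_)) α

-- mulLinear c X is (Σ_j c_j t_j)·X, so s = mulLinear ones and s_ω = mulLinear (lookup ω).
mulLinear : (Fin k → ℚ) → Poly k → Poly k
mulLinear {k} c X α = ∑[ j < k ] (c j * mulVar j X α)

ones : Fin k → ℚ
ones _ = 1ℚ

mulLinear-cong-size : ∀ (c : Fin k → ℚ) {X Y} α → (∀ β → suc (size β) ≡ size α → X β ≡ Y β) →
  mulLinear c X α ≡ mulLinear c Y α
mulLinear-cong-size c α eq = sum-cong-≗ (λ j → cong (c j *_) (mulVar-cong-size j α eq))

mulLinear-cong : ∀ (c : Fin k → ℚ) {X Y} α → (∀ β → X β ≡ Y β) →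
  mulLinear c X α ≡ mulLinear c Y α
mulLinear-cong c α eq = mulLinear-cong-size c α (λ β _ → eq β)

mulLinear-cong-atSize : ∀ (c : Fin k → ℚ) {X Y} α {N} → size α ≡ suc N →
  (∀ β → size β ≡ N → X β ≡ Y β) → mulLinear c X α ≡ mulLinear c Y α
mulLinear-cong-atSize c α α≡1+N eq =
  mulLinear-cong-size c α (λ β 1+β≡α → eq β (ℕ.suc-injective (trans 1+β≡α α≡1+N)))

mulLinear-zero : ∀ (c : Fin k → ℚ) α → mulLinear c 0P α ≡ 0ℚ
mulLinear-zero {k} c α = trans
  (sum-cong-≗ (λ j → trans (cong (c j *_) (ifPos-zero (lookup α j))) (ℚ.*-zeroʳ (c j))))
  (sum-replicate-zero k)

mulLinear-size0 : ∀ (c : Fin k → ℚ) X α → size α ≡ 0 → mulLinear c X α ≡ 0ℚ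
mulLinear-size0 c X α α≡0 =
  trans (mulLinear-cong-size c {X} {0P} α (λ β eq → contradiction (trans eq α≡0) λ ())) (mulLinear-zero c α)

mulLinear+mulLinear-size0 : ∀ (c d : Fin k → ℚ) X Y α → size α ≡ 0 →
  0ℚ ≡ mulLinear c X α + mulLinear d Y α
mulLinear+mulLinear-size0 c d X Y α α≡0 =
  trans (sym (ℚ.+-identityʳ 0ℚ)) (sym (cong₂ _+_ (mulLinear-size0 c X α α≡0) (mulLinear-size0 d Y α α≡0)))

mulLinear-*ˡ : ∀ (c : Fin k → ℚ) a X α → mulLinear c (λ β → a * X β) α ≡ a * mulLinear c X α
mulLinear-*ˡ c a X α = begin
  ∑[ j < _ ] (c j * ifPos (lookup α j) (a * X (α -ᵉ unit j)))
    ≡⟨ sum-cong-≗ (λ j → trans (cong (c j *_) (ifPos-*ˡ (lookup α j) a _)) (x∙yz≈y∙xz (c j) a _)) ⟩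
  ∑[ j < _ ] (a * (c j * mulVar j X α))
    ≡⟨ *-distribˡ-sum a (λ j → c j * mulVar j X α) ⟨
  a * mulLinear c X α ∎

mulLinear-ones : ∀ (X : Poly k) α → mulLinear ones X α ≡ ∑[ j < k ] mulVar j X α
mulLinear-ones X α = sum-cong-≗ (λ j → ℚ.*-identityˡ (mulVar j X α))

mulLinear-mulLinear : ∀ (c d : Fin k → ℚ) X α →
  mulLinear c (mulLinear d X) α ≡ ∑[ i < k ] ∑[ j < k ] (c i * (d j * mulVar i (mulVar j X) α))
mulLinear-mulLinear {k} c d X α = sum-cong-≗ λ i → begin
  c i * ifPos (lookup α i) (∑[ j < k ] (d j * mulVar j X (α -ᵉ unit i)))
    ≡⟨ cong (c i *_) (ifPos-sum (lookup α i) (λ j → d j * mulVar j X (α -ᵉ unit i))) ⟩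
  c i * ∑[ j < k ] ifPos (lookup α i) (d j * mulVar j X (α -ᵉ unit i))
    ≡⟨ cong (c i *_) (sum-cong-≗ (λ j → ifPos-*ˡ (lookup α i) (d j) _)) ⟩
  c i * ∑[ j < k ] (d j * mulVar i (mulVar j X) α)
    ≡⟨ *-distribˡ-sum (c i) (λ j → d j * mulVar i (mulVar j X) α) ⟩
  ∑[ j < k ] (c i * (d j * mulVar i (mulVar j X) α)) ∎

mulLinear-comm : ∀ (c d : Fin k → ℚ) X α → mulLinear c (mulLinear d X) α ≡ mulLinear d (mulLinear c X) α
mulLinear-comm {k} c d X α = begin
  mulLinear c (mulLinear d X) α
    ≡⟨ mulLinear-mulLinear c d X α ⟩
  ∑[ i < k ] ∑[ j < k ] (c i * (d j * mulVar i (mulVar j X) α))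
    ≡⟨ ∑-comm (λ i j → c i * (d j * mulVar i (mulVar j X) α)) ⟩
  ∑[ j < k ] ∑[ i < k ] (c i * (d j * mulVar i (mulVar j X) α))
    ≡⟨ sum-cong-≗ (λ j → sum-cong-≗ (λ i → trans (cong (λ z → c i * (d j * z)) (mulVar-comm i j X α))
                                                 (x∙yz≈y∙xz (c i) (d j) _))) ⟩
  ∑[ j < k ] ∑[ i < k ] (d j * (c i * mulVar j (mulVar i X) α))
    ≡⟨ mulLinear-mulLinear d c X α ⟨
  mulLinear d (mulLinear c X) α ∎

mulLinear-fixedPoint-unique : ∀ (c : Fin k → ℚ) (Y X Z : Poly k) →
  (∀ α → X α ≡ Y α + mulLinear c X α) → (∀ α → Z α ≡ Y α + mulLinear c Z α) →
  ∀ α → X α ≡ Z α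
mulLinear-fixedPoint-unique c Y X Z fixX fixZ α = go (suc (size α)) α ℕ.≤-refl
  where
  go : ∀ d α → size α < d → X α ≡ Z α
  go (suc d) α (s≤s α≤d) = begin
    X α                   ≡⟨ fixX α ⟩
    Y α + mulLinear c X α ≡⟨ cong (Y α +_) (mulLinear-cong-size c α smaller) ⟩
    Y α + mulLinear c Z α ≡⟨ fixZ α ⟨
    Z α                   ∎
    where
    smaller : ∀ β → suc (size β) ≡ size α → X β ≡ Z β
    smaller β 1+β≡α = go d β (subst (_≤ d) (sym 1+β≡α) α≤d)

convolution : Poly k → Poly k → Poly k
convolution X V α = sumBelow α (λ β → X β * V (α -ᵉ β))

*P≡convolution : ∀ (X V : Poly k) α → (X *P V) α ≡ convolution X V α
*P≡convolution X V α = sumℚ-map-below α (λ β → X β * V (α -ᵉ β))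

convolution-1P : ∀ (V : Poly k) α → convolution 1P V α ≡ V α
convolution-1P V []      = ℚ.*-identityˡ (V [])
convolution-1P V (a ∷ α) = begin
  convolution 1P (V ∘ (a ∷_)) α + sumℕ a (λ b → sumBelow α (λ β → 0ℚ * V ((a ∸ suc b) ∷ (α -ᵉ β))))
    ≡⟨ cong₂ _+_ (convolution-1P (V ∘ (a ∷_)) α)
                 (trans (sumℕ-cong a (λ b → zeroTerms (a ∸ suc b))) (sum-replicate-zero a)) ⟩
  V (a ∷ α) + 0ℚ
    ≡⟨ ℚ.+-identityʳ _ ⟩
  V (a ∷ α) ∎
  where
  zeroTerms : ∀ c → sumBelow α (λ β → 0ℚ * V (c ∷ (α -ᵉ β))) ≡ 0ℚ
  zeroTerms c = trans (sumBelow-cong α (λ β → ℚ.*-zeroˡ (V (c ∷ (α -ᵉ β))))) (sumBelow-zero α)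

convolution-mulVar : ∀ j (X V : Poly k) α → convolution (mulVar j X) V α ≡ mulVar j (convolution X V) α
convolution-mulVar Fin.zero X V (zero ∷ α) = begin
  sumBelow α (λ β → 0ℚ * V (0 ∷ (α -ᵉ β))) + 0ℚ ≡⟨ ℚ.+-identityʳ _ ⟩
  sumBelow α (λ β → 0ℚ * V (0 ∷ (α -ᵉ β)))      ≡⟨ sumBelow-cong α (λ β → ℚ.*-zeroˡ (V (0 ∷ (α -ᵉ β)))) ⟩
  sumBelow α (λ _ → 0ℚ)                         ≡⟨ sumBelow-zero α ⟩
  0ℚ                                            ∎
convolution-mulVar Fin.zero X V (suc a ∷ α) = begin
  sumBelow α (λ β → 0ℚ * V (suc a ∷ (α -ᵉ β)))
    + sumℕ (suc a) (λ b → sumBelow α (λ β → X (b ∷ (β -ᵉ zeroExp)) * V ((a ∸ b) ∷ (α -ᵉ β))))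
    ≡⟨ cong₂ _+_ (trans (sumBelow-cong α (λ β → ℚ.*-zeroˡ (V (suc a ∷ (α -ᵉ β))))) (sumBelow-zero α))
                 (sumℕ-cong (suc a) (λ b → sumBelow-cong α (λ β →
                   cong (λ γ → X (b ∷ γ) * V ((a ∸ b) ∷ (α -ᵉ β))) (-ᵉ-identityʳ β)))) ⟩
  0ℚ + convolution X V (a ∷ α)
    ≡⟨ ℚ.+-identityˡ _ ⟩
  convolution X V (a ∷ α)
    ≡⟨ cong (λ γ → convolution X V (a ∷ γ)) (-ᵉ-identityʳ α) ⟨
  convolution X V (a ∷ (α -ᵉ zeroExp)) ∎
convolution-mulVar (Fin.suc j) X V (a ∷ α) = begin
  sumℕ (suc a) (λ b → convolution (mulVar j (X ∘ (b ∷_))) (V ∘ ((a ∸ b) ∷_)) α)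
    ≡⟨ sumℕ-cong (suc a) (λ b → convolution-mulVar j (X ∘ (b ∷_)) (V ∘ ((a ∸ b) ∷_)) α) ⟩
  sumℕ (suc a) (λ b → ifPos (lookup α j) (convolution (X ∘ (b ∷_)) (V ∘ ((a ∸ b) ∷_)) (α -ᵉ unit j)))
    ≡⟨ ifPos-sum {suc a} (lookup α j)
         (λ b → convolution (X ∘ (toℕ b ∷_)) (V ∘ ((a ∸ toℕ b) ∷_)) (α -ᵉ unit j)) ⟨
  mulVar (Fin.suc j) (convolution X V) (a ∷ α) ∎

convolution-congˡ : ∀ {X Y : Poly k} V α → (∀ β → X β ≡ Y β) →
  convolution X V α ≡ convolution Y V α
convolution-congˡ V α eq = sumBelow-cong α (λ β → cong (_* V (α -ᵉ β)) (eq β))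

convolution-+ˡ : ∀ (X Y V : Poly k) α → convolution (X +P Y) V α ≡ convolution X V α + convolution Y V α
convolution-+ˡ X Y V α = trans (sumBelow-cong α (λ β → ℚ.*-distribʳ-+ (V (α -ᵉ β)) (X β) (Y β)))
                               (sumBelow-+ α (λ β → X β * V (α -ᵉ β)) (λ β → Y β * V (α -ᵉ β)))

convolution-mulLinear : ∀ (c : Fin k → ℚ) X V α →
  convolution (mulLinear c X) V α ≡ mulLinear c (convolution X V) α
convolution-mulLinear {k} c X V α = begin
  sumBelow α (λ β → mulLinear c X β * V (α -ᵉ β))
    ≡⟨ sumBelow-cong α (λ β → trans (*-distribʳ-sum (V (α -ᵉ β)) (λ j → c j * mulVar j X β))
                                    (sum-cong-≗ (λ j → ℚ.*-assoc (c j) _ _))) ⟩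
  sumBelow α (λ β → ∑[ j < k ] (c j * (mulVar j X β * V (α -ᵉ β))))
    ≡⟨ sumBelow-sum α (λ j β → c j * (mulVar j X β * V (α -ᵉ β))) ⟩
  ∑[ j < k ] sumBelow α (λ β → c j * (mulVar j X β * V (α -ᵉ β)))
    ≡⟨ sum-cong-≗ (λ j → trans (sumBelow-*ˡ α (c j) _) (cong (c j *_) (convolution-mulVar j X V α))) ⟩
  mulLinear c (convolution X V) α ∎

*P-mulLinear-rec : ∀ (c d : Fin k → ℚ) (X V : Poly k) →
  (∀ α → X α ≡ (mulLinear c 1P +P mulLinear d X) α) →
  ∀ α → (X *P V) α ≡ (mulLinear c V +P mulLinear d (X *P V)) α
*P-mulLinear-rec c d X V X-rec α = begin
  (X *P V) α
    ≡⟨ *P≡convolution X V α ⟩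
  convolution X V α
    ≡⟨ convolution-congˡ V α X-rec ⟩
  convolution (mulLinear c 1P +P mulLinear d X) V α
    ≡⟨ convolution-+ˡ (mulLinear c 1P) (mulLinear d X) V α ⟩
  convolution (mulLinear c 1P) V α + convolution (mulLinear d X) V α
    ≡⟨ cong₂ _+_ (convolution-mulLinear c 1P V α) (convolution-mulLinear d X V α) ⟩
  mulLinear c (convolution 1P V) α + mulLinear d (convolution X V) α
    ≡⟨ cong₂ _+_ (mulLinear-cong c α (convolution-1P V))
                 (mulLinear-cong d α (λ β → sym (*P≡convolution X V β))) ⟩
  mulLinear c V α + mulLinear d (X *P V) α ∎

weightParts : Poly k → Seq k
weightParts f n α = if weight α ≡ᵇ n then f α else 0ℚ

_^P_ : Poly k → ℕ → Poly k
f ^P zero  = 1P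
f ^P suc m = f *P (f ^P m)

unitSeq≡weightParts : ∀ n (α : Exp k) → unitSeq n α ≡ weightParts 1P n α
unitSeq≡weightParts zero    α with weight α in w
... | zero  = refl
... | suc _ = 1P-weight≡suc α w
unitSeq≡weightParts (suc n) α with weight α in w
... | zero  = refl
... | suc v = sym (trans (if-cong-then (suc v ≡ᵇ suc n) (1P-weight≡suc α w)) (if-eta (suc v ≡ᵇ suc n)))

levelProd-weightParts : ∀ {P Q : Seq k} {f g : Poly k} →
  (∀ n α → P n α ≡ weightParts f n α) → (∀ n α → Q n α ≡ weightParts g n α) →
  ∀ n α → levelProd P Q n α ≡ weightParts (f *P g) n α
levelProd-weightParts {P = P} {Q} {f} {g} P≡f Q≡g n α = begin
  sumℚ (map (λ i → (P i *P Q (n ∸ i)) α) (upTo (suc n)))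
    ≡⟨ sumℚ-map-upTo (λ i → (P i *P Q (n ∸ i)) α) (suc n) ⟩
  sumℕ (suc n) (λ i → (P i *P Q (n ∸ i)) α)
    ≡⟨ sumℕ-cong (suc n) (λ i → *P≡convolution (P i) (Q (n ∸ i)) α) ⟩
  sumℕ (suc n) (λ i → sumBelow α (λ β → P i β * Q (n ∸ i) (α -ᵉ β)))
    ≡⟨ sumBelow-sum {n = suc n} α (λ i β → P (toℕ i) β * Q (n ∸ toℕ i) (α -ᵉ β)) ⟨
  sumBelow α (λ β → sumℕ (suc n) (λ i → P i β * Q (n ∸ i) (α -ᵉ β)))
    ≡⟨ sumBelow-cong≤ α diagonal ⟩
  sumBelow α (λ β → if weight α ≡ᵇ n then f β * g (α -ᵉ β) else 0ℚ)
    ≡⟨ sumBelow-if (weight α ≡ᵇ n) α (λ β → f β * g (α -ᵉ β)) ⟩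
  (if weight α ≡ᵇ n then convolution f g α else 0ℚ)
    ≡⟨ if-cong-then (weight α ≡ᵇ n) (*P≡convolution f g α) ⟨
  weightParts (f *P g) n α ∎
  where
  diagonal : ∀ β → Pointwise _≤_ β α →
    sumℕ (suc n) (λ i → P i β * Q (n ∸ i) (α -ᵉ β)) ≡ (if weight α ≡ᵇ n then f β * g (α -ᵉ β) else 0ℚ)
  diagonal β β≤α = begin
    sumℕ (suc n) (λ i → P i β * Q (n ∸ i) γ)
      ≡⟨ sumℕ-cong (suc n) (λ i → trans (cong₂ _*_ (P≡f i β) (Q≡g (n ∸ i) γ))
                                        (if-*-if (weight β ≡ᵇ i) (weight γ ≡ᵇ n ∸ i) (f β) (g γ))) ⟩
    sumℕ (suc n) (λ i → if weight β ≡ᵇ i then (if weight γ ≡ᵇ n ∸ i then f β * g γ else 0ℚ) else 0ℚ)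
      ≡⟨ sumℕ-diagonal n (weight β) (weight γ) (f β * g γ) ⟩
    (if weight β ℕ.+ weight γ ≡ᵇ n then f β * g γ else 0ℚ)
      ≡⟨ cong (λ w → if w ≡ᵇ n then f β * g γ else 0ℚ) (weightFrom-+-∸ 1 β≤α) ⟩
    (if weight α ≡ᵇ n then f β * g γ else 0ℚ) ∎
    where
    γ = α -ᵉ β

levelPow-weightParts : ∀ {P : Seq k} {f : Poly k} → (∀ n α → P n α ≡ weightParts f n α) →
  ∀ m n α → levelPow P m n α ≡ weightParts (f ^P m) n α
levelPow-weightParts P≡f zero    = unitSeq≡weightParts
levelPow-weightParts P≡f (suc m) = levelProd-weightParts P≡f (levelPow-weightParts P≡f m)

weightParts-cong : ∀ {f g : Poly k} n α → (weight α ≡ n → f α ≡ g α) →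
  weightParts f n α ≡ weightParts g n α
weightParts-cong n α eq with weight α ≡ᵇ n in w
... | true  = eq (ℕ.≡ᵇ⇒≡ (weight α) n (subst T (sym w) _))
... | false = refl

sum-*-weightParts : ∀ M (c : ℕ → ℚ) (F : ℕ → Poly k) n α →
  sumℕ M (λ m → c m * weightParts (F m) n α) ≡ weightParts (λ β → sumℕ M (λ m → c m * F m β)) n α
sum-*-weightParts M c F n α with weight α ≡ᵇ n
... | true  = refl
... | false = trans (sumℕ-cong M (λ m → ℚ.*-zeroʳ (c m))) (sum-replicate-zero M)

A-size≡0 : ∀ (ω : Weight k) α → size α ≡ 0 → A ω α ≡ 0ℚ
A-size≡0 ω α α≡0 = cong (λ d → Aaux ω d α) α≡0

dropConst-isobaric : ∀ (ω : Weight k) n α → dropConst (isobaric ω) n α ≡ weightParts (A ω) n α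
dropConst-isobaric ω (suc n) α = refl
dropConst-isobaric ω zero    α with weight α in w
... | zero  = sym (A-size≡0 ω α (ℕ.n≤0⇒n≡0 (subst (size α ≤_) w (size≤weightFrom 0 α))))
... | suc _ = refl

A-rec-size1 : ∀ (ω : Weight k) α → size α ≡ 1 →
  A ω α ≡ mulLinear (lookup ω) 1P α + mulLinear ones (A ω) α
A-rec-size1 {k} ω α α≡1 = begin
  A ω α
    ≡⟨ cong (λ d → Aaux ω d α) α≡1 ⟩
  Aaux ω 1 α
    ≡⟨ sumℚ-map-allFin (λ j → ifPos (lookup α j) (lookup ω j)) ⟩
  ∑[ j < k ] ifPos (lookup α j) (lookup ω j)
    ≡⟨ sum-cong-≗ (λ j → trans (cong (ifPos (lookup α j)) (sym (ℚ.*-identityʳ (lookup ω j))))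
                               (ifPos-*ˡ (lookup α j) (lookup ω j) 1ℚ)) ⟩
  mulLinear (lookup ω) (λ _ → 1ℚ) α
    ≡⟨ mulLinear-cong-atSize (lookup ω) α α≡1 1P-size≡0 ⟨
  mulLinear (lookup ω) 1P α
    ≡⟨ ℚ.+-identityʳ _ ⟨
  mulLinear (lookup ω) 1P α + 0ℚ
    ≡⟨ cong (mulLinear (lookup ω) 1P α +_)
            (trans (mulLinear-cong-atSize ones α α≡1 (A-size≡0 ω)) (mulLinear-zero ones α)) ⟨
  mulLinear (lookup ω) 1P α + mulLinear ones (A ω) α ∎

A-rec-size2+ : ∀ (ω : Weight k) α {d} → size α ≡ suc (suc d) →
  A ω α ≡ mulLinear (lookup ω) 1P α + mulLinear ones (A ω) α
A-rec-size2+ {k} ω α {d} α≡2+d = begin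
  A ω α
    ≡⟨ cong (λ d → Aaux ω d α) α≡2+d ⟩
  Aaux ω (suc (suc d)) α
    ≡⟨ sumℚ-map-allFin (λ j → mulVar j (Aaux ω (suc d)) α) ⟩
  ∑[ j < k ] mulVar j (Aaux ω (suc d)) α
    ≡⟨ mulLinear-ones (Aaux ω (suc d)) α ⟨
  mulLinear ones (Aaux ω (suc d)) α
    ≡⟨ mulLinear-cong-atSize ones α α≡2+d (λ β β≡1+d → cong (λ d → Aaux ω d β) β≡1+d) ⟨
  mulLinear ones (A ω) α
    ≡⟨ ℚ.+-identityˡ _ ⟨
  0ℚ + mulLinear ones (A ω) α
    ≡⟨ cong (_+ mulLinear ones (A ω) α) (trans (mulLinear-cong-atSize (lookup ω) α α≡2+d (λ β → 1P-size≡suc β))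
                                               (mulLinear-zero (lookup ω) α)) ⟨
  mulLinear (lookup ω) 1P α + mulLinear ones (A ω) α ∎

A-rec : ∀ (ω : Weight k) α → A ω α ≡ (mulLinear (lookup ω) 1P +P mulLinear ones (A ω)) α
A-rec ω α = bySize (size α) refl
  where
  bySize : ∀ s → size α ≡ s → A ω α ≡ mulLinear (lookup ω) 1P α + mulLinear ones (A ω) α
  bySize zero          α≡0   = trans (A-size≡0 ω α α≡0) (mulLinear+mulLinear-size0 (lookup ω) ones 1P (A ω) α α≡0)
  bySize (suc zero)    α≡1   = A-rec-size1 ω α α≡1
  bySize (suc (suc _)) α≡2+d = A-rec-size2+ ω α α≡2+d

evalWith : (Exp k → ℚ) → MPoly k → ℚ
evalWith φ p = sumℚ (map (λ { (c , β) → c * φ β }) p)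

D₁ᵀ : (Exp k → ℚ) → Exp k → ℚ
D₁ᵀ {k} φ β = ∑[ i < k ] (ℕ→ℚ (lookup β i) * φ (β -ᵉ unit i))

evalWith-∂ : ∀ (φ : Exp k → ℚ) i p →
  evalWith φ (∂ i p) ≡ evalWith (λ β → ℕ→ℚ (lookup β i) * φ (β -ᵉ unit i)) p
evalWith-∂ φ i []            = refl
evalWith-∂ φ i ((c , β) ∷ p) = cong₂ _+_ (ℚ.*-assoc c _ _) (evalWith-∂ φ i p)

evalWith-sum : ∀ {n} (φ : Fin n → Exp k → ℚ) p →
  ∑[ i < n ] evalWith (φ i) p ≡ evalWith (λ β → ∑[ i < n ] φ i β) p
evalWith-sum {n = n} φ []            = sum-replicate-zero n
evalWith-sum {n = n} φ ((c , β) ∷ p) = begin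
  ∑[ i < n ] (c * φ i β + evalWith (φ i) p)
    ≡⟨ ∑-distrib-+ (λ i → c * φ i β) (λ i → evalWith (φ i) p) ⟩
  ∑[ i < n ] (c * φ i β) + ∑[ i < n ] evalWith (φ i) p
    ≡⟨ cong₂ _+_ (sym (*-distribˡ-sum c (λ i → φ i β))) (evalWith-sum φ p) ⟩
  c * ∑[ i < n ] φ i β + evalWith (λ β → ∑[ i < n ] φ i β) p ∎

evalWith-D₁ : ∀ (φ : Exp k → ℚ) p → evalWith φ (D₁ p) ≡ evalWith (D₁ᵀ φ) p
evalWith-D₁ {k} φ p = begin
  evalWith φ (concatMap (λ i → ∂ i p) (toList (allFin k)))
    ≡⟨ sumℚ-map-concatMap _ (λ i → ∂ i p) (toList (allFin k)) ⟩
  sumℚ (map (λ i → evalWith φ (∂ i p)) (toList (allFin k)))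
    ≡⟨ sumℚ-map-allFin (λ i → evalWith φ (∂ i p)) ⟩
  ∑[ i < k ] evalWith φ (∂ i p)
    ≡⟨ sum-cong-≗ (λ i → evalWith-∂ φ i p) ⟩
  ∑[ i < k ] evalWith (λ β → ℕ→ℚ (lookup β i) * φ (β -ᵉ unit i)) p
    ≡⟨ evalWith-sum (λ i β → ℕ→ℚ (lookup β i) * φ (β -ᵉ unit i)) p ⟩
  evalWith (D₁ᵀ φ) p ∎

evalWith-D : ∀ r (φ : Exp k → ℚ) p → evalWith φ (D r p) ≡ evalWith (iterate D₁ᵀ φ r) p
evalWith-D zero    φ p = refl
evalWith-D (suc r) φ p = trans (evalWith-D₁ φ (D r p)) (evalWith-D r (D₁ᵀ φ) p)

eval-D-monomial : ∀ (ω : Weight k) r α → eval ω (D r (monomial α)) ≡ fold (evalMono ω) D₁ᵀ r α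
eval-D-monomial ω r α = begin
  evalWith (evalMono ω) (D r (monomial α)) ≡⟨ evalWith-D r (evalMono ω) (monomial α) ⟩
  1ℚ * iterate D₁ᵀ (evalMono ω) r α + 0ℚ   ≡⟨ ℚ.+-identityʳ _ ⟩
  1ℚ * iterate D₁ᵀ (evalMono ω) r α        ≡⟨ ℚ.*-identityˡ _ ⟩
  iterate D₁ᵀ (evalMono ω) r α             ≡⟨ cong (λ φ → φ α) (iterate-is-fold (evalMono ω) D₁ᵀ r) ⟨
  fold (evalMono ω) D₁ᵀ r α                ∎

invFactProd-unit : ∀ (α : Exp k) i {c} → lookup α i ≡ suc c →
  invFactProd α * ℕ→ℚ (suc c) ≡ invFactProd (α -ᵉ unit i)
invFactProd-unit (suc a ∷ α) Fin.zero refl = begin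
  invFact (suc a) * invFactProd α * ℕ→ℚ (suc a)
    ≡⟨ solve 3 (λ x y z → x :* y :* z := x :* z :* y) refl
         (invFact (suc a)) (invFactProd α) (ℕ→ℚ (suc a)) ⟩
  invFact (suc a) * ℕ→ℚ (suc a) * invFactProd α
    ≡⟨ cong₂ _*_ (invFact-suc a) (cong invFactProd (sym (-ᵉ-identityʳ α))) ⟩
  invFact a * invFactProd (α -ᵉ zeroExp) ∎
invFactProd-unit (a ∷ α) (Fin.suc i) eq =
  trans (ℚ.*-assoc (invFact a) (invFactProd α) _) (cong (invFact a *_) (invFactProd-unit α i eq))

evalMono-unit : ∀ (ω : Weight k) α j {c} → lookup α j ≡ suc c →
  lookup ω j * evalMono ω (α -ᵉ unit j) ≡ evalMono ω α
evalMono-unit (w ∷ ω) (suc a ∷ α) Fin.zero refl = begin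
  w * ((w ^ℚ a) * evalMono ω (α -ᵉ zeroExp)) ≡⟨ ℚ.*-assoc w (w ^ℚ a) _ ⟨
  w * (w ^ℚ a) * evalMono ω (α -ᵉ zeroExp)   ≡⟨ cong (λ γ → w * (w ^ℚ a) * evalMono ω γ) (-ᵉ-identityʳ α) ⟩
  w * (w ^ℚ a) * evalMono ω α                ∎
evalMono-unit (w ∷ ω) (a ∷ α) (Fin.suc j) eq = begin
  lookup ω j * ((w ^ℚ a) * evalMono ω (α -ᵉ unit j)) ≡⟨ x∙yz≈y∙xz (lookup ω j) (w ^ℚ a) _ ⟩
  (w ^ℚ a) * (lookup ω j * evalMono ω (α -ᵉ unit j)) ≡⟨ cong ((w ^ℚ a) *_) (evalMono-unit ω α j eq) ⟩
  (w ^ℚ a) * evalMono ω α                            ∎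

divFact : (Exp k → ℚ) → Poly k
divFact φ α = invFactProd α * φ α

divFact-D₁ᵀ : ∀ (φ : Exp k → ℚ) α → divFact (D₁ᵀ φ) α ≡ mulLinear ones (divFact φ) α
divFact-D₁ᵀ {k} φ α = begin
  invFactProd α * ∑[ j < k ] (ℕ→ℚ (lookup α j) * φ (α -ᵉ unit j))
    ≡⟨ *-distribˡ-sum (invFactProd α) (λ j → ℕ→ℚ (lookup α j) * φ (α -ᵉ unit j)) ⟩
  ∑[ j < k ] (invFactProd α * (ℕ→ℚ (lookup α j) * φ (α -ᵉ unit j)))
    ≡⟨ sum-cong-≗ termwise ⟩
  ∑[ j < k ] mulVar j (divFact φ) α
    ≡⟨ mulLinear-ones (divFact φ) α ⟨
  mulLinear ones (divFact φ) α ∎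
  where
  termwise : ∀ j → invFactProd α * (ℕ→ℚ (lookup α j) * φ (α -ᵉ unit j)) ≡ mulVar j (divFact φ) α
  termwise j with lookup α j in e
  ... | zero  = trans (cong (invFactProd α *_) (ℚ.*-zeroˡ (φ (α -ᵉ unit j)))) (ℚ.*-zeroʳ (invFactProd α))
  ... | suc c = trans (sym (ℚ.*-assoc (invFactProd α) _ _)) (cong (_* φ (α -ᵉ unit j)) (invFactProd-unit α j e))

-- G_r(α) = (1/α!) D_r(ω^α), computed through the transpose D₁ᵀ of D₁ (see eval-D-monomial).
scaledD : Weight k → ℕ → Poly k
scaledD ω r = divFact (fold (evalMono ω) D₁ᵀ r)

scaledD-suc : ∀ (ω : Weight k) r α → scaledD ω (suc r) α ≡ mulLinear ones (scaledD ω r) α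
scaledD-suc ω r = divFact-D₁ᵀ (fold (evalMono ω) D₁ᵀ r)

scaledD-size≡0 : ∀ (ω : Weight k) α → size α ≡ 0 → scaledD ω 0 α ≡ 1ℚ
scaledD-size≡0 []      []         _   = refl
scaledD-size≡0 (w ∷ ω) (zero ∷ α) α≡0 = begin
  1ℚ * invFactProd α * (1ℚ * evalMono ω α)
    ≡⟨ cong₂ _*_ (ℚ.*-identityˡ (invFactProd α)) (ℚ.*-identityˡ (evalMono ω α)) ⟩
  invFactProd α * evalMono ω α
    ≡⟨ scaledD-size≡0 ω α α≡0 ⟩
  1ℚ ∎

mulLinear-scaledD : ∀ (ω : Weight k) r α →
  mulLinear (lookup ω) (scaledD ω r) α ≡ ℕ→ℚ (size α ∸ r) * scaledD ω r α
mulLinear-scaledD {k} ω zero α = begin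
  ∑[ j < k ] (lookup ω j * mulVar j (scaledD ω 0) α)   ≡⟨ sum-cong-≗ termwise ⟩
  ∑[ j < k ] (ℕ→ℚ (lookup α j) * scaledD ω 0 α)        ≡⟨ *-distribʳ-sum (scaledD ω 0 α) (ℕ→ℚ ∘ lookup α) ⟨
  ∑[ j < k ] ℕ→ℚ (lookup α j) * scaledD ω 0 α          ≡⟨ cong (_* scaledD ω 0 α) (size-sum α) ⟩
  ℕ→ℚ (size α) * scaledD ω 0 α                         ∎
  where
  termwise : ∀ j → lookup ω j * mulVar j (scaledD ω 0) α ≡ ℕ→ℚ (lookup α j) * scaledD ω 0 α
  termwise j with lookup α j in e
  ... | zero  = trans (ℚ.*-zeroʳ (lookup ω j)) (sym (ℚ.*-zeroˡ (scaledD ω 0 α)))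
  ... | suc c = begin
    w * (invFactProd (α -ᵉ unit j) * evalMono ω (α -ᵉ unit j))
      ≡⟨ cong (λ x → w * (x * evalMono ω (α -ᵉ unit j))) (invFactProd-unit α j e) ⟨
    w * (invFactProd α * ℕ→ℚ (suc c) * evalMono ω (α -ᵉ unit j))
      ≡⟨ solve 4 (λ w f n e → w :* (f :* n :* e) := n :* (f :* (w :* e))) refl
           w (invFactProd α) (ℕ→ℚ (suc c)) (evalMono ω (α -ᵉ unit j)) ⟩
    ℕ→ℚ (suc c) * (invFactProd α * (w * evalMono ω (α -ᵉ unit j)))
      ≡⟨ cong (λ x → ℕ→ℚ (suc c) * (invFactProd α * x)) (evalMono-unit ω α j e) ⟩
    ℕ→ℚ (suc c) * (invFactProd α * evalMono ω α) ∎
    where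
    w = lookup ω j
mulLinear-scaledD ω (suc r) α = begin
  mulLinear (lookup ω) (scaledD ω (suc r)) α
    ≡⟨ mulLinear-cong (lookup ω) α (scaledD-suc ω r) ⟩
  mulLinear (lookup ω) (mulLinear ones (scaledD ω r)) α
    ≡⟨ mulLinear-comm (lookup ω) ones (scaledD ω r) α ⟩
  mulLinear ones (mulLinear (lookup ω) (scaledD ω r)) α
    ≡⟨ mulLinear-cong ones α (mulLinear-scaledD ω r) ⟩
  mulLinear ones (λ β → ℕ→ℚ (size β ∸ r) * scaledD ω r β) α
    ≡⟨ mulLinear-cong-size ones α (λ β 1+β≡α → cong (λ s → ℕ→ℚ (s ∸ suc r) * scaledD ω r β) 1+β≡α) ⟩
  mulLinear ones (λ β → ℕ→ℚ (size α ∸ suc r) * scaledD ω r β) α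
    ≡⟨ mulLinear-*ˡ ones (ℕ→ℚ (size α ∸ suc r)) (scaledD ω r) α ⟩
  ℕ→ℚ (size α ∸ suc r) * mulLinear ones (scaledD ω r) α
    ≡⟨ cong (ℕ→ℚ (size α ∸ suc r) *_) (scaledD-suc ω r α) ⟨
  ℕ→ℚ (size α ∸ suc r) * scaledD ω (suc r) α ∎

C-*-cong : ∀ n m {x y} → (m ≤ n → x ≡ y) → ℕ→ℚ (n C m) * x ≡ ℕ→ℚ (n C m) * y
C-*-cong n m {x} {y} eq with m ℕ.≤? n
... | yes m≤n = cong (ℕ→ℚ (n C m) *_) (eq m≤n)
... | no  m≰n rewrite k>n⇒nCk≡0 (ℕ.≰⇒> m≰n) = trans (ℚ.*-zeroˡ x) (sym (ℚ.*-zeroˡ y))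

-- The value of [t^α] a^(m+1) when |α| = N + 1. The case |α| = 0 is separate because the formula,
-- read with truncated subtraction, would not vanish there for m = 0.
powClosedAt : Weight k → ℕ → ℕ → Poly k
powClosedAt ω m zero    α = 0ℚ
powClosedAt ω m (suc N) α = ℕ→ℚ (N C m) * (ℕ→ℚ (suc m !) * scaledD ω (N ∸ m) α)

powClosed : Weight k → ℕ → Poly k
powClosed ω zero    = 1P
powClosed ω (suc m) α = powClosedAt ω m (size α) α

mulLinear-powClosed : ∀ (ω : Weight k) c m α {N} → size α ≡ suc N →
  mulLinear c (powClosed ω (suc m)) α ≡ mulLinear c (powClosedAt ω m N) α
mulLinear-powClosed ω c m α α≡1+N =
  mulLinear-cong-atSize c α α≡1+N (λ β β≡N → cong (λ s → powClosedAt ω m s β) β≡N)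

mulLinear-powClosedAt : ∀ (ω : Weight k) c m N α →
  mulLinear c (powClosedAt ω m (suc N)) α
    ≡ ℕ→ℚ (N C m) * (ℕ→ℚ (suc m !) * mulLinear c (scaledD ω (N ∸ m)) α)
mulLinear-powClosedAt ω c m N α = begin
  mulLinear c (powClosedAt ω m (suc N)) α
    ≡⟨ mulLinear-*ˡ c (ℕ→ℚ (N C m)) (λ β → ℕ→ℚ (suc m !) * scaledD ω (N ∸ m) β) α ⟩
  ℕ→ℚ (N C m) * mulLinear c (λ β → ℕ→ℚ (suc m !) * scaledD ω (N ∸ m) β) α
    ≡⟨ cong (ℕ→ℚ (N C m) *_) (mulLinear-*ˡ c (ℕ→ℚ (suc m !)) (scaledD ω (N ∸ m)) α) ⟩
  ℕ→ℚ (N C m) * (ℕ→ℚ (suc m !) * mulLinear c (scaledD ω (N ∸ m)) α) ∎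

powClosed-suc-rec-size2+ : ∀ (ω : Weight k) m N α → size α ≡ suc (suc N) →
  powClosed ω (suc (suc m)) α
    ≡ mulLinear (lookup ω) (powClosed ω (suc m)) α + mulLinear ones (powClosed ω (suc (suc m))) α
powClosed-suc-rec-size2+ ω m N α α≡2+N = sym (begin
  mulLinear (lookup ω) (powClosed ω (suc m)) α + mulLinear ones (powClosed ω (suc (suc m))) α
    ≡⟨ cong₂ _+_ (trans (mulLinear-powClosed ω (lookup ω) m α α≡2+N) (mulLinear-powClosedAt ω (lookup ω) m N α))
                 (trans (mulLinear-powClosed ω ones (suc m) α α≡2+N) (mulLinear-powClosedAt ω ones (suc m) N α)) ⟩
  ℕ→ℚ (N C m) * (ℕ→ℚ (suc m !) * mulLinear (lookup ω) (scaledD ω (N ∸ m)) α)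
    + ℕ→ℚ (N C suc m) * (f * mulLinear ones (scaledD ω (N ∸ suc m)) α)
    ≡⟨ cong₂ (λ x y → ℕ→ℚ (N C m) * (ℕ→ℚ (suc m !) * x) + ℕ→ℚ (N C suc m) * (f * y))
             (trans (mulLinear-scaledD ω (N ∸ m) α) (cong (λ s → ℕ→ℚ (s ∸ (N ∸ m)) * g) α≡2+N))
             (sym (scaledD-suc ω (N ∸ suc m) α)) ⟩
  ℕ→ℚ (N C m) * (ℕ→ℚ (suc m !) * (ℕ→ℚ (suc (suc N) ∸ (N ∸ m)) * g))
    + ℕ→ℚ (N C suc m) * (f * scaledD ω (suc (N ∸ suc m)) α)
    ≡⟨ cong₂ _+_ (C-*-cong N m fromLeft) (C-*-cong N (suc m) fromRight) ⟩
  ℕ→ℚ (N C m) * (f * g) + ℕ→ℚ (N C suc m) * (f * g)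
    ≡⟨ ℚ.*-distribʳ-+ (f * g) (ℕ→ℚ (N C m)) (ℕ→ℚ (N C suc m)) ⟨
  (ℕ→ℚ (N C m) + ℕ→ℚ (N C suc m)) * (f * g)
    ≡⟨ cong (_* (f * g)) (trans (sym (ℕ→ℚ-+ (N C m) (N C suc m)))
                                (cong ℕ→ℚ (nCk+nC[k+1]≡[n+1]C[k+1] N m))) ⟩
  ℕ→ℚ (suc N C suc m) * (f * g)
    ≡⟨ cong (λ s → powClosedAt ω (suc m) s α) α≡2+N ⟨
  powClosed ω (suc (suc m)) α ∎)
  where
  f = ℕ→ℚ (suc (suc m) !)
  g = scaledD ω (N ∸ m) α
  fromLeft : m ≤ N → ℕ→ℚ (suc m !) * (ℕ→ℚ (suc (suc N) ∸ (N ∸ m)) * g) ≡ f * g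
  fromLeft m≤N = begin
    ℕ→ℚ (suc m !) * (ℕ→ℚ (suc (suc N) ∸ (N ∸ m)) * g)
      ≡⟨ cong (λ s → ℕ→ℚ (suc m !) * (ℕ→ℚ s * g))
              (trans (ℕ.+-∸-assoc 2 (ℕ.m∸n≤m N m)) (cong (2 ℕ.+_) (ℕ.m∸[m∸n]≡n m≤N))) ⟩
    ℕ→ℚ (suc m !) * (ℕ→ℚ (suc (suc m)) * g)
      ≡⟨ solve 3 (λ x y z → x :* (y :* z) := y :* x :* z) refl (ℕ→ℚ (suc m !)) (ℕ→ℚ (suc (suc m))) g ⟩
    ℕ→ℚ (suc (suc m)) * ℕ→ℚ (suc m !) * g
      ≡⟨ cong (_* g) (ℕ→ℚ-* (suc (suc m)) (suc m !)) ⟨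
    f * g ∎
  fromRight : suc m ≤ N → f * scaledD ω (suc (N ∸ suc m)) α ≡ f * g
  fromRight 1+m≤N = cong (λ r → f * scaledD ω r α) (sym (ℕ.+-∸-assoc 1 1+m≤N))

mulLinear-powClosed-size1 : ∀ (ω : Weight k) c m α → size α ≡ 1 → mulLinear c (powClosed ω (suc m)) α ≡ 0ℚ
mulLinear-powClosed-size1 ω c m α α≡1 = trans (mulLinear-powClosed ω c m α α≡1) (mulLinear-zero c α)

powClosed-one-rec-size1 : ∀ (ω : Weight k) α → size α ≡ 1 →
  powClosed ω 1 α ≡ mulLinear (lookup ω) 1P α + mulLinear ones (powClosed ω 1) α
powClosed-one-rec-size1 ω α α≡1 = begin
  powClosed ω 1 α
    ≡⟨ cong (λ s → powClosedAt ω 0 s α) α≡1 ⟩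
  1ℚ * (1ℚ * scaledD ω 0 α)
    ≡⟨ trans (ℚ.*-identityˡ _) (ℚ.*-identityˡ _) ⟩
  scaledD ω 0 α
    ≡⟨ trans (mulLinear-scaledD ω 0 α) (trans (cong (λ s → ℕ→ℚ (s ∸ 0) * scaledD ω 0 α) α≡1) (ℚ.*-identityˡ _)) ⟨
  mulLinear (lookup ω) (scaledD ω 0) α
    ≡⟨ mulLinear-cong-atSize (lookup ω) α α≡1 (λ β β≡0 → trans (scaledD-size≡0 ω β β≡0) (sym (1P-size≡0 β β≡0))) ⟩
  mulLinear (lookup ω) 1P α
    ≡⟨ ℚ.+-identityʳ _ ⟨
  mulLinear (lookup ω) 1P α + 0ℚ
    ≡⟨ cong (mulLinear (lookup ω) 1P α +_) (mulLinear-powClosed-size1 ω ones 0 α α≡1) ⟨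
  mulLinear (lookup ω) 1P α + mulLinear ones (powClosed ω 1) α ∎

powClosed-one-rec-size2+ : ∀ (ω : Weight k) α {N} → size α ≡ suc (suc N) →
  powClosed ω 1 α ≡ mulLinear (lookup ω) 1P α + mulLinear ones (powClosed ω 1) α
powClosed-one-rec-size2+ ω α {N} α≡2+N = begin
  powClosed ω 1 α
    ≡⟨ cong (λ s → powClosedAt ω 0 s α) α≡2+N ⟩
  1ℚ * (1ℚ * scaledD ω (suc N) α)
    ≡⟨ cong (λ x → 1ℚ * (1ℚ * x)) (scaledD-suc ω N α) ⟩
  1ℚ * (1ℚ * mulLinear ones (scaledD ω N) α)
    ≡⟨ trans (mulLinear-powClosed ω ones 0 α α≡2+N) (mulLinear-powClosedAt ω ones 0 N α) ⟨
  mulLinear ones (powClosed ω 1) α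
    ≡⟨ ℚ.+-identityˡ _ ⟨
  0ℚ + mulLinear ones (powClosed ω 1) α
    ≡⟨ cong (_+ mulLinear ones (powClosed ω 1) α)
            (trans (mulLinear-cong-atSize (lookup ω) α α≡2+N (λ β → 1P-size≡suc β)) (mulLinear-zero (lookup ω) α)) ⟨
  mulLinear (lookup ω) 1P α + mulLinear ones (powClosed ω 1) α ∎

powClosed-suc-rec-size1 : ∀ (ω : Weight k) m α → size α ≡ 1 →
  powClosed ω (suc (suc m)) α
    ≡ mulLinear (lookup ω) (powClosed ω (suc m)) α + mulLinear ones (powClosed ω (suc (suc m))) α
powClosed-suc-rec-size1 ω m α α≡1 = begin
  powClosed ω (suc (suc m)) α
    ≡⟨ cong (λ s → powClosedAt ω (suc m) s α) α≡1 ⟩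
  0ℚ * (ℕ→ℚ (suc (suc m) !) * scaledD ω 0 α)
    ≡⟨ ℚ.*-zeroˡ (ℕ→ℚ (suc (suc m) !) * scaledD ω 0 α) ⟩
  0ℚ
    ≡⟨ ℚ.+-identityʳ 0ℚ ⟨
  0ℚ + 0ℚ
    ≡⟨ cong₂ _+_ (mulLinear-powClosed-size1 ω (lookup ω) m α α≡1) (mulLinear-powClosed-size1 ω ones (suc m) α α≡1) ⟨
  mulLinear (lookup ω) (powClosed ω (suc m)) α + mulLinear ones (powClosed ω (suc (suc m))) α ∎

powClosed-rec : ∀ (ω : Weight k) m α →
  powClosed ω (suc m) α ≡ (mulLinear (lookup ω) (powClosed ω m) +P mulLinear ones (powClosed ω (suc m))) α
powClosed-rec ω m α = bySize m (size α) refl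
  where
  bySize : ∀ m s → size α ≡ s →
    powClosed ω (suc m) α ≡ mulLinear (lookup ω) (powClosed ω m) α + mulLinear ones (powClosed ω (suc m)) α
  bySize m       zero          α≡0   = trans (cong (λ s → powClosedAt ω m s α) α≡0)
    (mulLinear+mulLinear-size0 (lookup ω) ones (powClosed ω m) (powClosed ω (suc m)) α α≡0)
  bySize zero    (suc zero)    α≡1   = powClosed-one-rec-size1 ω α α≡1
  bySize (suc m) (suc zero)    α≡1   = powClosed-suc-rec-size1 ω m α α≡1
  bySize zero    (suc (suc N)) α≡2+N = powClosed-one-rec-size2+ ω α α≡2+N
  bySize (suc m) (suc (suc N)) α≡2+N = powClosed-suc-rec-size2+ ω m N α α≡2+N

^P≡powClosed : ∀ (ω : Weight k) m α → (A ω ^P m) α ≡ powClosed ω m α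
^P≡powClosed ω zero    α = refl
^P≡powClosed ω (suc m) α = mulLinear-fixedPoint-unique ones (mulLinear (lookup ω) (powClosed ω m))
  (A ω ^P suc m) (powClosed ω (suc m)) powA-rec (powClosed-rec ω m) α
  where
  powA-rec : ∀ β →
    (A ω ^P suc m) β ≡ mulLinear (lookup ω) (powClosed ω m) β + mulLinear ones (A ω ^P suc m) β
  powA-rec β = trans (*P-mulLinear-rec (lookup ω) ones (A ω) (A ω ^P m) (A-rec ω) β)
                     (cong (_+ mulLinear ones (A ω ^P suc m) β) (mulLinear-cong (lookup ω) β (^P≡powClosed ω m)))

binomℚ-*-powClosed : ∀ (ω : Weight k) q m α {N} → size α ≡ suc N →
  binomℚ q (suc m) * powClosed ω (suc m) α ≡ B q m * ℕ→ℚ (N C m) * scaledD ω (N ∸ m) α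
binomℚ-*-powClosed ω q m α {N} α≡1+N = begin
  binomℚ q (suc m) * powClosed ω (suc m) α
    ≡⟨ cong (λ s → binomℚ q (suc m) * powClosedAt ω m s α) α≡1+N ⟩
  B q m * invFact (suc m) * (ℕ→ℚ (N C m) * (ℕ→ℚ (suc m !) * scaledD ω (N ∸ m) α))
    ≡⟨ solve 5 (λ b i c f s → b :* i :* (c :* (f :* s)) := b :* c :* s :* (i :* f)) refl
         (B q m) (invFact (suc m)) (ℕ→ℚ (N C m)) (ℕ→ℚ (suc m !)) (scaledD ω (N ∸ m) α) ⟩
  B q m * ℕ→ℚ (N C m) * scaledD ω (N ∸ m) α * (invFact (suc m) * ℕ→ℚ (suc m !))
    ≡⟨ trans (cong (B q m * ℕ→ℚ (N C m) * scaledD ω (N ∸ m) α *_) (invFact-* (suc m)))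
             (ℚ.*-identityʳ _) ⟩
  B q m * ℕ→ℚ (N C m) * scaledD ω (N ∸ m) α ∎

L≡sumℕ : ∀ (ω : Weight k) q α {N} → size α ≡ suc N →
  L ω q α ≡ sumℕ (suc N) (λ j → B q j * ℕ→ℚ (N C j) * scaledD ω (N ∸ j) α)
L≡sumℕ ω q α {N} α≡1+N = begin
  L ω q α
    ≡⟨ sumℚ-map-upTo (term (size α)) (size α) ⟩
  sumℕ (size α) (term (size α))
    ≡⟨ cong (λ s → sumℕ s (term s)) α≡1+N ⟩
  sumℕ (suc N) (term (suc N))
    ≡⟨ sumℕ-cong (suc N) termwise ⟩
  sumℕ (suc N) (λ j → B q j * ℕ→ℚ (N C j) * scaledD ω (N ∸ j) α) ∎
  where
  term : ℕ → ℕ → ℚ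
  term s j = invFactProd α * ℕ→ℚ ((s ∸ 1) C j) * B q j * eval ω (D (s ∸ j ∸ 1) (monomial α))
  termwise : ∀ j → term (suc N) j ≡ B q j * ℕ→ℚ (N C j) * scaledD ω (N ∸ j) α
  termwise j = begin
    invFactProd α * ℕ→ℚ (N C j) * B q j * eval ω (D (suc N ∸ j ∸ 1) (monomial α))
      ≡⟨ cong (λ r → invFactProd α * ℕ→ℚ (N C j) * B q j * eval ω (D r (monomial α)))
              (trans (ℕ.∸-+-assoc (suc N) j 1) (cong (suc N ∸_) (ℕ.+-comm j 1))) ⟩
    invFactProd α * ℕ→ℚ (N C j) * B q j * eval ω (D (N ∸ j) (monomial α))
      ≡⟨ solve 4 (λ i c b e → i :* c :* b :* e := b :* c :* (i :* e)) refl
           (invFactProd α) (ℕ→ℚ (N C j)) (B q j) (eval ω (D (N ∸ j) (monomial α))) ⟩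
    B q j * ℕ→ℚ (N C j) * (invFactProd α * eval ω (D (N ∸ j) (monomial α)))
      ≡⟨ cong (λ x → B q j * ℕ→ℚ (N C j) * (invFactProd α * x)) (eval-D-monomial ω (N ∸ j) α) ⟩
    B q j * ℕ→ℚ (N C j) * scaledD ω (N ∸ j) α ∎

binomial-sum≡L : ∀ (ω : Weight k) q α {n} → weight α ≡ suc n →
  sumℕ (suc (suc n)) (λ m → binomℚ q m * (A ω ^P m) α) ≡ L ω q α
binomial-sum≡L ω q α {n} w≡1+n with weight≡suc⇒size≡suc α w≡1+n
... | N , α≡1+N , N≤n = begin
  binomℚ q 0 * 1P α + sumℕ (suc n) (λ m → binomℚ q (suc m) * (A ω ^P suc m) α)
    ≡⟨ cong₂ _+_ (trans (cong (binomℚ q 0 *_) (1P-size≡suc α α≡1+N)) (ℚ.*-zeroʳ (binomℚ q 0)))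
                 (sumℕ-cong (suc n) (λ m → trans (cong (binomℚ q (suc m) *_) (^P≡powClosed ω (suc m) α))
                                                 (binomℚ-*-powClosed ω q m α α≡1+N))) ⟩
  0ℚ + sumℕ (suc n) term
    ≡⟨ ℚ.+-identityˡ _ ⟩
  sumℕ (suc n) term
    ≡⟨ sumℕ-vanishing term vanish (s≤s N≤n) ⟩
  sumℕ (suc N) term
    ≡⟨ L≡sumℕ ω q α α≡1+N ⟨
  L ω q α ∎
  where
  term : ℕ → ℚ
  term j = B q j * ℕ→ℚ (N C j) * scaledD ω (N ∸ j) α
  vanish : ∀ j → suc N ≤ j → term j ≡ 0ℚ
  vanish j N<j rewrite k>n⇒nCk≡0 N<j =
    trans (cong (_* scaledD ω (N ∸ j) α) (ℚ.*-zeroʳ (B q j))) (ℚ.*-zeroˡ (scaledD ω (N ∸ j) α))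

theorem11 : (k : ℕ) → k ≥ 1 → (ω : Weight k) (q : ℚ) →
    ∀ (n : ℕ) (α : Exp k) → Hseq ω q n α ≡ levelRoot q (isobaric ω) n α
theorem11 k _ ω q zero α = sym (trans (ℚ.+-identityʳ _) (ℚ.*-identityˡ (1P α)))
theorem11 k _ ω q (suc n) α = sym (begin
  levelRoot q (isobaric ω) (suc n) α
    ≡⟨ sumℚ-map-upTo (λ m → binomℚ q m * levelPow (dropConst (isobaric ω)) m (suc n) α) (suc (suc n)) ⟩
  sumℕ (suc (suc n)) (λ m → binomℚ q m * levelPow (dropConst (isobaric ω)) m (suc n) α)
    ≡⟨ sumℕ-cong (suc (suc n))
         (λ m → cong (binomℚ q m *_) (levelPow-weightParts (dropConst-isobaric ω) m (suc n) α)) ⟩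
  sumℕ (suc (suc n)) (λ m → binomℚ q m * weightParts (A ω ^P m) (suc n) α)
    ≡⟨ sum-*-weightParts (suc (suc n)) (binomℚ q) (A ω ^P_) (suc n) α ⟩
  weightParts (λ β → sumℕ (suc (suc n)) (λ m → binomℚ q m * (A ω ^P m) β)) (suc n) α
    ≡⟨ weightParts-cong {f = λ β → sumℕ (suc (suc n)) (λ m → binomℚ q m * (A ω ^P m) β)} {L ω q}
         (suc n) α (binomial-sum≡L ω q α) ⟩
  Hseq ω q (suc n) α ∎)
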